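{- Let $\alpha \in [0,1]$, let $\mathcal{G}_1 = (G_1, S, \mu_1, l_1)$ and $\mathcal{G}_2 = (G_2, S, \mu_2, l_2)$ be comparable reconciled gene trees, and let $uv \in E(G_1)$ be a redundant edge of $\mathcal{G}_1$. Then $d_{PLR}(\mathcal{G}_1, \mathcal{G}_2) \geq d_{PLR}(\mathcal{G}_1 / uv, \mathcal{G}_2)$.
   Context: All trees are rooted; $L(T)$ is the leaf set, $L(T(v))$ the leaves descending from $v$, $\mathrm{lca}_T$ lowest common ancestor, $dist_T$ path length in edges. A species tree $S$ is a rooted binary tree. A reconciled gene tree is a tuple $\mathcal{G} = (G, S, \mu, l)$ where $G$ is a rooted tree in which every internal node has at least two children, $\mu : V(G) \to V(S)$, $l : V(G) \to \{dup, spec, extant\}$, such that: (1) leaves map to leaves of $S$ and have label $extant$, internal nodes have label $dup$ or $spec$; (2) $u \preceq_G v$ implies $\mu(u) \preceq_S \mu(v)$; (3) if $l(v) = spec$ then $\mu(v)$ is internal in $S$, $v$ has exactly two children $v_1,v_2$, and with $s_1,s_2$ the children of $\mu(v)$, either $\mu(v_1) \preceq_S s_1, \mu(v_2) \preceq_S s_2$ or $\mu(v_2) \preceq_S s_1, \mu(v_1) \preceq_S s_2$. $\mathcal{G}_1,\mathcal{G}_2$ are comparable if they use the same $S$, $L(G_1)=L(G_2)$ and $\mu_1(x)=\mu_2(x)$ for every leaf $x$. For $v \in V(G_1)$, $m(v) = \mathrm{lca}_{G_2}(L(G_1(v)))$; $d_{path}(\mathcal{G}_1,\mathcal{G}_2)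 = \sum_{v \in V(G_1)} dist_S(\mu_1(v), \mu_2(m(v)))$; $d_{lbl}(\mathcal{G}_1,\mathcal{G}_2) = |\{v \in V(G_1): l_1(v) \neq l_2(m(v))\}|$; $d_{asym} = \alpha d_{path} + (1-\alpha) d_{lbl}$; $d_{PLR}(\mathcal{G}_1,\mathcal{G}_2) = d_{asym}(\mathcal{G}_1,\mathcal{G}_2) + d_{asym}(\mathcal{G}_2,\mathcal{G}_1)$ (and $\infty$ if not comparable). An edge $uv$ with $u$ the parent of $v$ is redundant if $\mu(u) = \mu(v)$ and $l(u)=l(v)=dup$. For a redundant edge $uv$ of $\mathcal{G} = (G,S,\mu,l)$, $\mathcal{G}/uv = (G', S, \mu', l')$ where $G'$ is obtained from $G$ by deleting $v$ and its incident edges and adding an edge from $u$ to each child of $v$ in $G$, and $\mu', l'$ are the restrictions of $\mu, l$ to $V(G')$.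
   Formalization: The parameter α ranges only over the rational points of $[0,1]$. -}

module Defs where

open import Data.Nat using (ℕ; zero; suc; _+_; _∸_; _≤_)
open import Data.Integer using (+_)
open import Data.Rational using (ℚ; _/_; _*_; _-_; 1ℚ)
import Data.Rational as Q
open import Data.List using (List; []; _∷_; _++_; _∷ʳ_; length; map; filter)
open import Data.Nat.ListAction using (sum)
open import Data.List.Membership.Propositional using (_∈_)
open import Data.List.Relation.Unary.All using (all?)
open import Data.List.Relation.Unary.Any using (any?)
open import Data.List.Relation.Unary.Unique.Propositional using (Unique)
open import Data.Maybe using (Maybe; just; nothing)
open import Data.Product using (Σ; ∃; _×_; _,_)
open import Data.Sum using (_⊎_)
open import Relation.Binary.PropositionalEquality using (_≡_; _≢_; refl)
open import Relation.Nullary using (Dec; yes; no; ¬?)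
import Data.Nat as N

-- Species trees: rooted binary trees (only the shape matters; the
-- vertices of S are identified with their positions = paths from root).

data Sp : Set where
  sleaf : Sp
  snode : Sp → Sp → Sp

data Side : Set where
  left right : Side

_≟S_ : (a b : Side) → Dec (a ≡ b)
left  ≟S left  = yes refl
left  ≟S right = no (λ ())
right ≟S left  = no (λ ())
right ≟S right = yes refl

SPos : Set
SPos = List Side

sSub : Sp → SPos → Maybe Sp
sSub S [] = just S
sSub sleaf (_ ∷ _) = nothing
sSub (snode A B) (left ∷ p) = sSub A p
sSub (snode A B) (right ∷ p) = sSub B p

SVertex : Sp → SPos → Set
SVertex S p = ∃ λ T → sSub S p ≡ just T

SLeaf : Sp → SPos → Set
SLeaf S p = sSub S p ≡ just sleaf

SInternal : Sp → SPos → Set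
SInternal S p = Σ Sp λ A → Σ Sp λ B → sSub S p ≡ just (snode A B)

-- p is a prefix of q, i.e. q ⪯ p (q is a descendant of, or equal to, p)
IsPrefix : {A : Set} → List A → List A → Set
IsPrefix {A} p q = Σ (List A) λ r → p ++ r ≡ q

-- length of the longest common prefix = depth of lca_S
lcpLen : SPos → SPos → ℕ
lcpLen (a ∷ p) (b ∷ q) with a ≟S b
... | yes _ = suc (lcpLen p q)
... | no _ = zero
lcpLen _ _ = zero

distS : SPos → SPos → ℕ
distS p q = (length p ∸ lcpLen p q) + (length q ∸ lcpLen p q)

-- Gene trees with their reconciliation data stored at the vertices.
-- gleaf x s : leaf (gene) named x with μ = s and label extant
-- gnode l s cs : internal vertex with label l, μ = s, children cs

data Lbl : Set where
  dup spec extant : Lbl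

_≟L_ : (a b : Lbl) → Dec (a ≡ b)
dup ≟L dup = yes refl
dup ≟L spec = no (λ ())
dup ≟L extant = no (λ ())
spec ≟L dup = no (λ ())
spec ≟L spec = yes refl
spec ≟L extant = no (λ ())
extant ≟L dup = no (λ ())
extant ≟L spec = no (λ ())
extant ≟L extant = yes refl

data GT : Set where
  gleaf : ℕ → SPos → GT
  gnode : Lbl → SPos → List GT → GT

rootμ : GT → SPos
rootμ (gleaf _ s) = s
rootμ (gnode _ s _) = s

rootL : GT → Lbl
rootL (gleaf _ _) = extant
rootL (gnode l _ _) = l

GPos : Set
GPos = List ℕ

mutual
  sub : GT → GPos → Maybe GT
  sub t [] = just t
  sub (gleaf _ _) (_ ∷ _) = nothing
  sub (gnode _ _ cs) (i ∷ p) = subL cs i p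

  subL : List GT → ℕ → GPos → Maybe GT
  subL [] _ _ = nothing
  subL (c ∷ cs) zero p = sub c p
  subL (c ∷ cs) (suc i) p = subL cs i p

mutual
  leaves : GT → List ℕ
  leaves (gleaf x _) = x ∷ []
  leaves (gnode _ _ cs) = leavesL cs

  leavesL : List GT → List ℕ
  leavesL [] = []
  leavesL (c ∷ cs) = leaves c ++ leavesL cs

-- all subtrees G(v), one per vertex v ∈ V(G)
mutual
  subtrees : GT → List GT
  subtrees t@(gleaf _ _) = t ∷ []
  subtrees t@(gnode _ _ cs) = t ∷ subtreesL cs

  subtreesL : List GT → List GT
  subtreesL [] = []
  subtreesL (c ∷ cs) = subtrees c ++ subtreesL cs

record Reconciled (S : Sp) (G : GT) : Set where
  field
    leavesUnique : Unique (leaves G)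
    -- (1) leaves map to leaves of S (and have label extant by construction)
    leafMap : ∀ p x s → sub G p ≡ just (gleaf x s) → SLeaf S s
    internalMap : ∀ p l s cs → sub G p ≡ just (gnode l s cs) →
                  SVertex S s × l ≢ extant × 2 ≤ length cs
    monotone : ∀ p q t t' → sub G p ≡ just t → sub G (p ++ q) ≡ just t' →
               IsPrefix (rootμ t) (rootμ t')
    speciation : ∀ p s cs → sub G p ≡ just (gnode spec s cs) →
      SInternal S s ×
      Σ GT λ v₁ → Σ GT λ v₂ → cs ≡ v₁ ∷ v₂ ∷ [] ×
        ((IsPrefix (s ∷ʳ left) (rootμ v₁) × IsPrefix (s ∷ʳ right) (rootμ v₂)) ⊎
         (IsPrefix (s ∷ʳ left) (rootμ v₂) × IsPrefix (s ∷ʳ right) (rootμ v₁)))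

-- comparability (the shared S is expressed by using the same S for both)
record Comparable (G₁ G₂ : GT) : Set where
  field
    sameLeaves₁ : ∀ x → x ∈ leaves G₁ → x ∈ leaves G₂
    sameLeaves₂ : ∀ x → x ∈ leaves G₂ → x ∈ leaves G₁
    sameLeafMap : ∀ x p₁ p₂ s₁ s₂ → sub G₁ p₁ ≡ just (gleaf x s₁) →
                  sub G₂ p₂ ≡ just (gleaf x s₂) → s₁ ≡ s₂

-- lca_G(X): the lowest vertex whose subtree contains all of X
-- (returned as the subtree rooted at that vertex; only its μ and l are used)

_⊆?_ : (X Y : List ℕ) → Dec (∀ {x} → x ∈ X → x ∈ Y) 
X ⊆? Y = helper (all? (λ x → any? (x N.≟_) Y) X)
  where
  open import Data.List.Relation.Unary.All using (All; lookup)
  helper : Dec (All (λ x → x ∈ Y) X) → Dec (∀ {x} → x ∈ X → x ∈ Y)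
  helper (yes a) = yes (lookup a)
  helper (no na) = no (λ f → na (Data.List.Relation.Unary.All.tabulate f))

mutual
  lcaT : GT → List ℕ → GT
  lcaT t@(gleaf _ _) X = t
  lcaT t@(gnode _ _ cs) X = lcaL t cs X

  lcaL : GT → List GT → List ℕ → GT
  lcaL d [] X = d
  lcaL d (c ∷ cs) X with X ⊆? leaves c
  ... | yes _ = lcaT c X
  ... | no _ = lcaL d cs X

mT : GT → GT → GT
mT G₂ t = lcaT G₂ (leaves t)

dPath : GT → GT → ℕ
dPath G₁ G₂ = sum (map (λ t → distS (rootμ t) (rootμ (mT G₂ t))) (subtrees G₁))

dLbl : GT → GT → ℕ
dLbl G₁ G₂ = length (filter (λ t → ¬? (rootL t ≟L rootL (mT G₂ t))) (subtrees G₁))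

toℚ : ℕ → ℚ
toℚ n = + n / 1

dAsym : ℚ → GT → GT → ℚ
dAsym α G₁ G₂ = (α * toℚ (dPath G₁ G₂)) Q.+ ((1ℚ - α) * toℚ (dLbl G₁ G₂))

-- d_PLR for comparable reconciled gene trees (the ∞ case is not needed)
dPLR : ℚ → GT → GT → ℚ
dPLR α G₁ G₂ = dAsym α G₁ G₂ Q.+ dAsym α G₂ G₁

-- redundant edges and contraction
-- The edge uv is given by the position p of u and the index i of v
-- among u's children (so v is at position p ∷ʳ i).

Redundant : GT → GPos → ℕ → Set
Redundant G p i = Σ GT λ u → Σ GT λ v →
  sub G p ≡ just u × sub G (p ∷ʳ i) ≡ just v ×
  rootμ u ≡ rootμ v × rootL u ≡ dup × rootL v ≡ dup

splice : ℕ → List GT → List GT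
splice _ [] = []
splice zero (gleaf x s ∷ cs) = gleaf x s ∷ cs
splice zero (gnode _ _ ds ∷ cs) = ds ++ cs
splice (suc i) (c ∷ cs) = c ∷ splice i cs

mutual
  contract : GT → GPos → ℕ → GT
  contract (gleaf x s) _ _ = gleaf x s
  contract (gnode l s cs) [] i = gnode l s (splice i cs)
  contract (gnode l s cs) (j ∷ p) i = gnode l s (contractL cs j p i)

  contractL : List GT → ℕ → GPos → ℕ → List GT
  contractL [] _ _ _ = []
  contractL (c ∷ cs) zero p i = contract c p i ∷ cs
  contractL (c ∷ cs) (suc j) p i = c ∷ contractL cs j p i

-- Contracting a redundant edge uv of G₁ deletes the vertex v and changes no
-- other vertex's μ, label or cluster, so every per-vertex sum over G₁ can only
-- shrink: d_asym(G₁/uv, G₂) ≤ d_asym(G₁, G₂). In the other direction, a cluster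
-- X of G₂ whose lca in G₁ is v has its lca in G₁/uv at u, and since μ(u) = μ(v)
-- and l(u) = l(v) = dup, the lca mappings m agree on μ and label:
-- d_asym(G₂, G₁/uv) = d_asym(G₂, G₁).
module Submission where

open import Defs
open import Data.Nat using (ℕ)
open import Data.Rational using (ℚ; _≤_; 0ℚ; 1ℚ)

open import Function using (_∘_; _∘′_)
open import Data.Product using (_×_; _,_; proj₁; proj₂)
open import Data.Maybe using (Maybe; just)
open import Data.Nat as ℕ using (zero; suc)
import Data.Nat.Properties as ℕₚ
open import Data.Nat.ListAction using (sum)
open import Data.Integer as ℤ using (+_; +≤+)
import Data.Integer.Properties as ℤₚ
open import Data.Rational using (*≤*; _+_; _*_; _-_; -_; nonNegative)
open import Data.Rational.Properties
  using (normalize-coprime; ≤-trans; ≤-reflexive; +-inverseʳ; +-mono-≤; +-monoˡ-≤;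
         *-monoˡ-≤-nonNeg)
open import Data.Nat.Coprimality using (1-coprimeTo) renaming (sym to coprime-sym)
open import Data.List using (List; []; _∷_; _++_; _∷ʳ_; map; length)
open import Data.List.Properties using (++-assoc; map-cong; filter-≐)
open import Data.List.Membership.Propositional.Properties using (∈-++⁺ʳ)
open import Data.List.Relation.Unary.Any using (here; there)
import Data.List.Relation.Unary.All as All
import Data.List.Relation.Unary.All.Properties as Allₚ
open import Data.List.Relation.Unary.AllPairs using ([]; _∷_)
open import Data.List.Relation.Unary.Unique.Propositional using (Unique)
open import Data.List.Relation.Binary.Disjoint.Propositional using (Disjoint)
open import Data.List.Relation.Binary.Subset.Propositional using (_⊆_)
open import Data.List.Relation.Binary.Subset.Propositional.Properties
  using (⊆-trans; xs⊆xs++ys; xs⊆ys++xs)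
open import Data.List.Relation.Binary.Sublist.Heterogeneous as Sub using (Sublist; []; _∷_)
open import Data.List.Relation.Binary.Sublist.Heterogeneous.Properties
  using (++⁺; length-mono-≤; ⊆-filter-Sublist; module Reflexivity)
open import Data.Empty using (⊥-elim)
open import Relation.Nullary using (¬_; yes; no; ¬?; contradiction)
open import Relation.Binary.PropositionalEquality
  using (_≡_; _≢_; refl; sym; trans; cong; cong₂; subst; subst₂; module ≡-Reasoning)

open ≡-Reasoning

module _ {A : Set} where

  Unique-++⁻ˡ : ∀ (xs : List A) {ys} → Unique (xs ++ ys) → Unique xs
  Unique-++⁻ˡ []       _          = []
  Unique-++⁻ˡ (x ∷ xs) (x∉ ∷ xs!) = Allₚ.++⁻ˡ xs x∉ ∷ Unique-++⁻ˡ xs xs!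

  Unique-++⁻ʳ : ∀ (xs : List A) {ys} → Unique (xs ++ ys) → Unique ys
  Unique-++⁻ʳ []       ys!       = ys!
  Unique-++⁻ʳ (x ∷ xs) (_ ∷ xs!) = Unique-++⁻ʳ xs xs!

  Unique-++⇒Disjoint : ∀ (xs : List A) {ys} → Unique (xs ++ ys) → Disjoint xs ys
  Unique-++⇒Disjoint (x ∷ xs) (x∉ ∷ _)  (here refl , v∈ys) = All.lookup x∉ (∈-++⁺ʳ xs v∈ys) refl
  Unique-++⇒Disjoint (x ∷ xs) (_ ∷ xs!) (there v∈xs , v∈ys) = Unique-++⇒Disjoint xs xs! (v∈xs , v∈ys)

sum-map-mono : ∀ {A B : Set} {R : A → B → Set} (f : A → ℕ) (g : B → ℕ) →
               (∀ {a b} → R a b → f a ≡ g b) →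
               ∀ {xs ys} → Sublist R xs ys → sum (map f xs) ℕ.≤ sum (map g ys)
sum-map-mono f g resp []            = ℕ.z≤n
sum-map-mono f g resp (y Sub.∷ʳ rs) = ℕₚ.≤-trans (sum-map-mono f g resp rs) (ℕₚ.m≤n+m _ (g y))
sum-map-mono f g resp (r ∷ rs)      = ℕₚ.+-mono-≤ (ℕₚ.≤-reflexive (resp r)) (sum-map-mono f g resp rs)

leavesL-++ : ∀ cs ds → leavesL (cs ++ ds) ≡ leavesL cs ++ leavesL ds
leavesL-++ []       ds = refl
leavesL-++ (c ∷ cs) ds = trans (cong (leaves c ++_) (leavesL-++ cs ds)) (sym (++-assoc (leaves c) _ _))

subtreesL-++ : ∀ cs ds → subtreesL (cs ++ ds) ≡ subtreesL cs ++ subtreesL ds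
subtreesL-++ []       ds = refl
subtreesL-++ (c ∷ cs) ds = trans (cong (subtrees c ++_) (subtreesL-++ cs ds)) (sym (++-assoc (subtrees c) _ _))

leavesL-splice : ∀ i cs → leavesL (splice i cs) ≡ leavesL cs
leavesL-splice i       []                  = refl
leavesL-splice zero    (gleaf _ _ ∷ cs)    = refl
leavesL-splice zero    (gnode _ _ ds ∷ cs) = leavesL-++ ds cs
leavesL-splice (suc i) (c ∷ cs)            = cong (leaves c ++_) (leavesL-splice i cs)

mutual
  leaves-contract : ∀ G p i → leaves (contract G p i) ≡ leaves G
  leaves-contract (gleaf _ _)    p       i = refl
  leaves-contract (gnode _ _ cs) []      i = leavesL-splice i cs
  leaves-contract (gnode _ _ cs) (j ∷ p) i = leavesL-contractL cs j p i

  leavesL-contractL : ∀ cs j p i → leavesL (contractL cs j p i) ≡ leavesL cs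
  leavesL-contractL []       j       p i = refl
  leavesL-contractL (c ∷ cs) zero    p i = cong (_++ leavesL cs) (leaves-contract c p i)
  leavesL-contractL (c ∷ cs) (suc j) p i = cong (leaves c ++_) (leavesL-contractL cs j p i)

tag : GT → SPos × Lbl
tag t = rootμ t , rootL t

-- Vertices are represented by their subtrees; contraction rebuilds the subtrees of
-- the ancestors of v, but keeps their μ, label and cluster.
record SameVertex (a b : GT) : Set where
  constructor _,_
  field
    tag≡    : tag a ≡ tag b
    leaves≡ : leaves a ≡ leaves b

open Reflexivity {R = SameVertex} (refl , refl) using () renaming (refl to ⊆-refl)

splice-⊆ : ∀ i cs → Sublist SameVertex (subtreesL (splice i cs)) (subtreesL cs)
splice-⊆ i       []                  = []
splice-⊆ zero    (gleaf x s ∷ cs)    = ⊆-refl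
splice-⊆ zero    (gnode l s ds ∷ cs) =
  subst (λ vs → Sublist SameVertex vs (subtrees (gnode l s ds) ++ subtreesL cs))
        (sym (subtreesL-++ ds cs)) (gnode l s ds Sub.∷ʳ ⊆-refl)
splice-⊆ (suc i) (c ∷ cs)            = ++⁺ ⊆-refl (splice-⊆ i cs)

mutual
  contract-⊆ : ∀ G p i → Sublist SameVertex (subtrees (contract G p i)) (subtrees G)
  contract-⊆ (gleaf _ _)    p       i = ⊆-refl
  contract-⊆ (gnode _ _ cs) []      i = (refl , leavesL-splice i cs) ∷ splice-⊆ i cs
  contract-⊆ (gnode _ _ cs) (j ∷ p) i = (refl , leavesL-contractL cs j p i) ∷ contractL-⊆ cs j p i

  contractL-⊆ : ∀ cs j p i → Sublist SameVertex (subtreesL (contractL cs j p i)) (subtreesL cs)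
  contractL-⊆ []       j       p i = []
  contractL-⊆ (c ∷ cs) zero    p i = ++⁺ (contract-⊆ c p i) ⊆-refl
  contractL-⊆ (c ∷ cs) (suc j) p i = ++⁺ ⊆-refl (contractL-⊆ cs j p i)

dPath-contract-≤ : ∀ G p i H → dPath (contract G p i) H ℕ.≤ dPath G H
dPath-contract-≤ G p i H = sum-map-mono cost cost resp (contract-⊆ G p i)
  where
  cost : GT → ℕ
  cost t = distS (rootμ t) (rootμ (mT H t))

  resp : ∀ {a b} → SameVertex a b → cost a ≡ cost b
  resp (tag≡ , leaves≡) =
    cong₂ (λ (x : SPos × Lbl) X → distS (proj₁ x) (rootμ (lcaT H X))) tag≡ leaves≡

dLbl-contract-≤ : ∀ G p i H → dLbl (contract G p i) H ℕ.≤ dLbl G H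
dLbl-contract-≤ G p i H = length-mono-≤ (⊆-filter-Sublist mismatch? mismatch? resp (contract-⊆ G p i))
  where
  mismatch? = λ t → ¬? (rootL t ≟L rootL (mT H t))

  resp : ∀ {a b} → SameVertex a b → rootL a ≢ rootL (mT H a) → rootL b ≢ rootL (mT H b)
  resp (tag≡ , leaves≡) a≢ b≡ =
    a≢ (trans (cong proj₂ tag≡) (trans b≡ (cong (rootL ∘ lcaT H) (sym leaves≡))))

LcaTagsAgree : GT → GT → Set
LcaTagsAgree G' G = ∀ X → tag (lcaT G' X) ≡ tag (lcaT G X)

lcaL-here : ∀ {X} d c cs → X ⊆ leaves c → lcaL d (c ∷ cs) X ≡ lcaT c X
lcaL-here {X} d c cs X⊆c with X ⊆? leaves c
... | yes _   = refl
... | no X⊈c = ⊥-elim (X⊈c X⊆c)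

lcaL-there : ∀ {X} d c cs → ¬ X ⊆ leaves c → lcaL d (c ∷ cs) X ≡ lcaL d cs X
lcaL-there {X} d c cs X⊈c with X ⊆? leaves c
... | yes X⊆c = ⊥-elim (X⊈c X⊆c)
... | no _    = refl

lcaL-++ : ∀ d cs ds X → lcaL d (cs ++ ds) X ≡ lcaL (lcaL d ds X) cs X
lcaL-++ d []       ds X = refl
lcaL-++ d (c ∷ cs) ds X with X ⊆? leaves c
... | yes _ = refl
... | no _  = lcaL-++ d cs ds X

lcaL-default : ∀ d cs X → ¬ X ⊆ leavesL cs → lcaL d cs X ≡ d
lcaL-default d []       X X⊈cs = refl
lcaL-default d (c ∷ cs) X X⊈cs with X ⊆? leaves c
... | yes X⊆c = ⊥-elim (X⊈cs (⊆-trans X⊆c (xs⊆xs++ys _ _)))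
... | no _    = lcaL-default d cs X (λ X⊆cs → X⊈cs (⊆-trans X⊆cs (xs⊆ys++xs _ (leaves c))))

lcaL-tag : ∀ {d d'} cs X → tag d' ≡ tag d → tag (lcaL d' cs X) ≡ tag (lcaL d cs X)
lcaL-tag []       X d'≡d = d'≡d
lcaL-tag (c ∷ cs) X d'≡d with X ⊆? leaves c
... | yes _ = refl
... | no _  = lcaL-tag cs X d'≡d

-- ds ≢ [] matters for the empty cluster, whose lca search always descends to
-- the first child.
data Collapsible : Maybe GT → Maybe GT → Set where
  collapsible : ∀ {u l s ds} → tag u ≡ (s , l) → ds ≢ [] → Collapsible (just u) (just (gnode l s ds))

redundant⇒collapsible : ∀ {S G} → Reconciled S G → ∀ p i → Redundant G p i →
                        Collapsible (sub G p) (sub G (p ∷ʳ i))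
redundant⇒collapsible rec p i (u , gleaf _ _ , _ , _ , _ , _ , ())
redundant⇒collapsible rec p i (u , gnode l s ds , u∈ , v∈ , μ≡ , u-dup , v-dup) =
  subst₂ Collapsible (sym u∈) (sym v∈) (collapsible (cong₂ _,_ μ≡ (trans u-dup (sym v-dup))) ds≢[])
  where
  ds≢[] : ds ≢ []
  ds≢[] refl with Reconciled.internalMap rec (p ∷ʳ i) l s [] v∈
  ... | _ , _ , ()

lcaL-splice : ∀ cs i {d d'} → tag d' ≡ tag d → Collapsible (just d) (subL cs i []) → Unique (leavesL cs) →
              ∀ X → tag (lcaL d' (splice i cs) X) ≡ tag (lcaL d cs X)
lcaL-splice []                        i    d'≡d ()
lcaL-splice (gnode l s [] ∷ cs)       zero d'≡d (collapsible _ ds≢[]) uniq X  = contradiction refl ds≢[]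
lcaL-splice (gnode l s (e ∷ es) ∷ cs) zero d'≡d (collapsible _ _)     uniq [] = refl
lcaL-splice (gnode l s ds ∷ cs) zero {d} {d'} d'≡d (collapsible d≡v _) uniq X@(x ∷ _)
  with X ⊆? leavesL ds
-- Leaves are distinct, so no later sibling of v contains X: the search in G ends
-- at v, while in the contraction it falls back to u, which carries v's tag.
... | yes X⊆v = begin
  tag (lcaL d' (ds ++ cs) X)      ≡⟨ cong tag (lcaL-++ d' ds cs X) ⟩
  tag (lcaL (lcaL d' cs X) ds X)  ≡⟨ lcaL-tag ds X (trans (cong tag (lcaL-default d' cs X X⊈cs)) d'≡v) ⟩
  tag (lcaL (gnode l s ds) ds X)  ∎
  where
  d'≡v : tag d' ≡ (s , l)
  d'≡v = trans d'≡d d≡v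

  X⊈cs : ¬ X ⊆ leavesL cs
  X⊈cs X⊆cs = Unique-++⇒Disjoint (leavesL ds) uniq (X⊆v (here refl) , X⊆cs (here refl))
... | no X⊈v = begin
  tag (lcaL d' (ds ++ cs) X)      ≡⟨ cong tag (lcaL-++ d' ds cs X) ⟩
  tag (lcaL (lcaL d' cs X) ds X)  ≡⟨ cong tag (lcaL-default _ ds X X⊈v) ⟩
  tag (lcaL d' cs X)              ≡⟨ lcaL-tag cs X d'≡d ⟩
  tag (lcaL d cs X)               ∎
lcaL-splice (c ∷ cs) (suc i) d'≡d coll uniq X with X ⊆? leaves c
... | yes _ = refl
... | no _  = lcaL-splice cs i d'≡d coll (Unique-++⁻ʳ (leaves c) uniq) X

mutual
  lca-contract : ∀ G p i → Collapsible (sub G p) (sub G (p ∷ʳ i)) → Unique (leaves G) →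
                 LcaTagsAgree (contract G p i) G
  lca-contract (gleaf _ _)    []      i ()
  lca-contract (gleaf _ _)    (_ ∷ _) i ()
  lca-contract (gnode _ _ cs) []      i coll uniq = lcaL-splice cs i refl coll uniq
  lca-contract (gnode _ _ cs) (j ∷ p) i coll uniq = lcaL-contractL cs j p i coll uniq refl

  lcaL-contractL : ∀ cs j p i → Collapsible (subL cs j p) (subL cs j (p ∷ʳ i)) → Unique (leavesL cs) →
                   ∀ {d d'} → tag d' ≡ tag d →
                   ∀ X → tag (lcaL d' (contractL cs j p i) X) ≡ tag (lcaL d cs X)
  lcaL-contractL []       j       p i ()
  lcaL-contractL (c ∷ cs) zero    p i coll uniq d'≡d X with X ⊆? leaves c
  ... | yes X⊆c = trans (cong tag (lcaL-here _ _ cs (subst (X ⊆_) (sym (leaves-contract c p i)) X⊆c)))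
                        (lca-contract c p i coll (Unique-++⁻ˡ (leaves c) uniq) X)
  ... | no X⊈c  = trans (cong tag (lcaL-there _ _ cs (X⊈c ∘′ subst (X ⊆_) (leaves-contract c p i))))
                        (lcaL-tag cs X d'≡d)
  lcaL-contractL (c ∷ cs) (suc j) p i coll uniq d'≡d X with X ⊆? leaves c
  ... | yes _ = refl
  ... | no _  = lcaL-contractL cs j p i coll (Unique-++⁻ʳ (leaves c) uniq) d'≡d X

dPath-congʳ : ∀ H G G' → LcaTagsAgree G' G → dPath H G' ≡ dPath H G
dPath-congʳ H G G' lca≡ =
  cong sum (map-cong (λ t → cong (distS (rootμ t) ∘ proj₁) (lca≡ (leaves t))) (subtrees H))

dLbl-congʳ : ∀ H G G' → LcaTagsAgree G' G → dLbl H G' ≡ dLbl H G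
dLbl-congʳ H G G' lca≡ =
  cong length (filter-≐ (mismatch? G') (mismatch? G) ((λ {t} → to t) , (λ {t} → from t)) (subtrees H))
  where
  mismatch? = λ K t → ¬? (rootL t ≟L rootL (mT K t))

  l≡ : ∀ t → rootL (mT G' t) ≡ rootL (mT G t)
  l≡ t = cong proj₂ (lca≡ (leaves t))

  to : ∀ t → rootL t ≢ rootL (mT G' t) → rootL t ≢ rootL (mT G t)
  to t ne e = ne (trans e (sym (l≡ t)))

  from : ∀ t → rootL t ≢ rootL (mT G t) → rootL t ≢ rootL (mT G' t)
  from t ne e = ne (trans e (l≡ t))

toℚ-mono : ∀ {m n} → m ℕ.≤ n → toℚ m ≤ toℚ n
toℚ-mono {m} {n} m≤n
  rewrite normalize-coprime (coprime-sym (1-coprimeTo m))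
        | normalize-coprime (coprime-sym (1-coprimeTo n)) =
  *≤* (subst₂ ℤ._≤_ (sym (ℤₚ.*-identityʳ (+ m))) (sym (ℤₚ.*-identityʳ (+ n))) (+≤+ m≤n))

convex-mono : ∀ {α a a' b b'} → 0ℚ ≤ α → α ≤ 1ℚ → a ℕ.≤ a' → b ℕ.≤ b' →
              α * toℚ a + (1ℚ - α) * toℚ b ≤ α * toℚ a' + (1ℚ - α) * toℚ b'
convex-mono {α} 0≤α α≤1 a≤a' b≤b' =
  +-mono-≤ (*-monoˡ-≤-nonNeg α {{nonNegative 0≤α}} (toℚ-mono a≤a'))
           (*-monoˡ-≤-nonNeg (1ℚ - α) {{nonNegative 0≤1-α}} (toℚ-mono b≤b'))
  where
  0≤1-α : 0ℚ ≤ 1ℚ - α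
  0≤1-α = ≤-trans (≤-reflexive (sym (+-inverseʳ α))) (+-monoˡ-≤ (- α) α≤1)

lemma2 : (α : ℚ) → 0ℚ ≤ α → α ≤ 1ℚ →
         (S : Sp) (G₁ G₂ : GT) →
         Reconciled S G₁ → Reconciled S G₂ → Comparable G₁ G₂ →
         (p : GPos) (i : ℕ) → Redundant G₁ p i →
         dPLR α (contract G₁ p i) G₂ ≤ dPLR α G₁ G₂
lemma2 α 0≤α α≤1 S G₁ G₂ rec₁ _ _ p i redundant =
  +-mono-≤ (convex-mono 0≤α α≤1 (dPath-contract-≤ G₁ p i G₂) (dLbl-contract-≤ G₁ p i G₂))
           (convex-mono 0≤α α≤1 (ℕₚ.≤-reflexive (dPath-congʳ G₂ G₁ (contract G₁ p i) lca≡))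
                                (ℕₚ.≤-reflexive (dLbl-congʳ G₂ G₁ (contract G₁ p i) lca≡)))
  where
  lca≡ : LcaTagsAgree (contract G₁ p i) G₁
  lca≡ = lca-contract G₁ p i (redundant⇒collapsible rec₁ p i redundant) (Reconciled.leavesUnique rec₁)
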